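{- Let $N$ be a finite set with $|N|\ge2$. The cone $B(N)$ is the conic hull of the union of the linear space $L(N)$ of modular set functions and the set $\{ -\delta_S:\emptyset\neq S\subsetneq N\}$.
   Context: $L(N)$ is the set of $m:\mathcal{P}(N)\to\mathbb{R}$ with $m(C\cup D)+m(C\cap D)=m(C)+m(D)$ for all $C,D\subseteq N$. $\delta_S\in\mathbb{R}^{\mathcal{P}(N)}$ is the indicator of the single set $S$ ($\delta_S(S)=1$, $\delta_S(T)=0$ for $T\ne S$). For $m\in\mathbb{R}^{\mathcal{P}(N)}$ let $\tilde m(S)=m(S)-m(\emptyset)$; $B(N)$ is the set of $m$ for which $\{x\in\mathbb{R}^N:\sum_{i\in N}x_i=\tilde m(N),\ \sum_{i\in S}x_i\ge\tilde m(S)\ \forall S\subseteq N\}\ne\emptyset$. -}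

module Defs where

open import Level using (0ℓ)
open import Data.Nat using (ℕ; zero; suc)
open import Data.Bool using (Bool; true; false; if_then_else_)
open import Data.Bool.Properties using () renaming (_≟_ to _≟ᵇ_)
open import Data.Fin using (Fin)
open import Data.Vec using (Vec; lookup)
open import Data.Vec.Properties using (≡-dec)
open import Data.Fin.Subset using (Subset; _∪_; _∩_; ⊥; ⊤)
open import Data.Product using (Σ; ∃; _×_; _,_)
open import Data.Sum using (_⊎_)
open import Relation.Nullary using (¬_; does)
open import Relation.Binary.PropositionalEquality using (_≡_)
open import Relation.Binary using (Rel)
open import Relation.Binary.Structures using (IsTotalOrder)
open import Algebra.Structures using (IsCommutativeRing)

record OrderedField : Set₁ where
  infixl 6 _+_
  infixl 7 _*_
  infix 4 _≈_ _≤_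
  field
    Carrier : Set
    _≈_ : Rel Carrier 0ℓ
    _+_ _*_ : Carrier → Carrier → Carrier
    -_ : Carrier → Carrier
    0# 1# : Carrier
    isCommutativeRing : IsCommutativeRing _≈_ _+_ _*_ -_ 0# 1#
    0≉1 : ¬ (0# ≈ 1#)
    inverse : ∀ x → ¬ (x ≈ 0#) → ∃ λ y → (x * y) ≈ 1#
    _≤_ : Rel Carrier 0ℓ
    isTotalOrder : IsTotalOrder _≈_ _≤_
    +-mono-≤ : ∀ {x y} z → x ≤ y → (x + z) ≤ (y + z)
    *-nonneg : ∀ {x y} → 0# ≤ x → 0# ≤ y → 0# ≤ (x * y)

module _ (F : OrderedField) where
  open OrderedField F

  -- set functions m : P(N) → F, with N = Fin n and subsets as characteristic vectors
  SetFn : ℕ → Set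
  SetFn n = Subset n → Carrier

  sumFin : ∀ {n} → (Fin n → Carrier) → Carrier
  sumFin {zero} f = 0#
  sumFin {suc n} f = f Fin.zero + sumFin (λ i → f (Fin.suc i))

  sumOver : ∀ {n} → Subset n → (Fin n → Carrier) → Carrier
  sumOver S x = sumFin (λ i → if lookup S i then x i else 0#)

  Modular : ∀ {n} → SetFn n → Set
  Modular m = ∀ C D → (m (C ∪ D) + m (C ∩ D)) ≈ (m C + m D)

  δ : ∀ {n} → Subset n → SetFn n
  δ S T = if does (≡-dec _≟ᵇ_ S T) then 1# else 0#

  tilde : ∀ {n} → SetFn n → SetFn n
  tilde m S = m S + - (m ⊥)

  InB : ∀ {n} → SetFn n → Set
  InB {n} m = ∃ λ (x : Fin n → Carrier) →
    (sumOver ⊤ x ≈ tilde m ⊤) × (∀ S → tilde m S ≤ sumOver S x)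

  sumFinFn : ∀ {n k} → (Fin k → Carrier) → (Fin k → SetFn n) → SetFn n
  sumFinFn c v S = sumFin (λ j → c j * v j S)

  ConicHull : ∀ {n} → (SetFn n → Set) → SetFn n → Set
  ConicHull {n} P m = Σ ℕ λ k → Σ (Fin k → Carrier) λ c → Σ (Fin k → SetFn n) λ v →
    (∀ j → 0# ≤ c j) × (∀ j → P (v j)) × (∀ S → m S ≈ sumFinFn c v S)

  Generators : ∀ {n} → SetFn n → Set
  Generators {n} v = Modular v ⊎
    (∃ λ (S : Subset n) → ¬ (S ≡ ⊥) × ¬ (S ≡ ⊤) × (∀ T → v T ≈ (- (δ S T))))

-- A point x of the core of m̃ splits m as a modular function minus a nonnegative
-- combination of indicators: m = M − Σ_T d(T) δ_T with M(T) = m(∅) + x(T) and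
-- excess d(T) = x(T) − m̃(T) ≥ 0, which vanishes at ∅ and at N.  Conversely B(N) is
-- a convex cone (a nonnegative combination of core points is a core point of the
-- combination), and it contains L(N), whose members m satisfy m̃(S) = Σ_{i∈S} m̃({i}),
-- as well as each −δ_S with ∅ ≠ S ≠ N, which has the core point 0.
module Submission where

open import Defs
open import Data.Nat as ℕ using (ℕ; zero; suc; _≥_)
open import Data.Product using (_×_; ∃; _,_; proj₁; proj₂)
open import Level using (0ℓ)
open import Data.Bool using (true; false; if_then_else_; _∨_; _∧_)
open import Data.Bool.Properties using () renaming (_≟_ to _≟ᵇ_)
open import Data.Fin using (Fin; zero; suc; _↑ˡ_; _↑ʳ_)
open import Data.Fin.Subset using (Subset; _∪_; _∩_; ⊥; ⊤; ⁅_⁆)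
open import Data.Fin.Subset.Properties using (∪-identityˡ; ∩-zeroˡ)
open import Data.Vec using ([]; _∷_; lookup)
open import Data.Vec.Properties using (≡-dec; lookup-zipWith)
open import Data.Vec.Functional using (Vector; map; _++_)
open import Data.Vec.Functional.Properties using (lookup-++ˡ; lookup-++ʳ)
open import Data.Sum using (inj₁; inj₂)
open import Data.Empty using (⊥-elim)
open import Relation.Nullary using (¬_; yes; no)
open import Relation.Binary.PropositionalEquality using (_≡_; refl; cong; subst₂)
open import Relation.Binary.Bundles using (Poset)
open import Relation.Binary.Structures using (IsTotalOrder)
open import Algebra.Bundles using (CommutativeRing)
import Relation.Binary.Reasoning.Setoid
import Relation.Binary.Reasoning.PartialOrder

module _ (F : OrderedField) where
  open OrderedField F

  commutativeRing : CommutativeRing 0ℓ 0ℓ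
  commutativeRing = record { isCommutativeRing = isCommutativeRing }

  open CommutativeRing commutativeRing using (setoid; semiring; ring; +-abelianGroup; +-group;
    +-commutativeSemigroup; +-cong; +-congˡ; +-congʳ; *-cong; *-congˡ; +-assoc; +-comm;
    +-identityˡ; +-identityʳ; *-identityˡ; *-identityʳ; -‿cong; -‿inverseʳ; -‿inverseˡ; zeroˡ; zeroʳ)
    renaming (refl to ≈-refl; sym to ≈-sym; trans to ≈-trans; reflexive to ≈-reflexive)
  open import Algebra.Properties.Ring ring using (-‿distribʳ-*; x[y-z]≈xy-xz)
  open import Algebra.Properties.Group +-group using (ε⁻¹≈ε; ⁻¹-involutive; x≈y⇒x∙y⁻¹≈ε)
  open import Algebra.Properties.AbelianGroup +-abelianGroup using (⁻¹-∙-comm; xyx⁻¹≈y; ⁻¹-anti-homo‿-)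
  open import Algebra.Properties.CommutativeSemigroup +-commutativeSemigroup using (interchange)
  open import Algebra.Properties.Semiring.Sum semiring
    using (sum; sum-cong-≋; sum-replicate-zero; ∑-distrib-+; ∑-comm; *-distribˡ-sum)
  open IsTotalOrder isTotalOrder using (total; antisym)
    renaming (refl to ≤-refl; trans to ≤-trans; reflexive to ≤-reflexive)

  poset : Poset 0ℓ 0ℓ 0ℓ
  poset = record { isPartialOrder = IsTotalOrder.isPartialOrder isTotalOrder }

  module ≈-Reasoning = Relation.Binary.Reasoning.Setoid setoid
  module ≤-Reasoning = Relation.Binary.Reasoning.PartialOrder poset

  infixl 6 _-_
  _-_ : Carrier → Carrier → Carrier
  x - y = x + - y

  x+[y-x]≈y : ∀ x y → x + (y - x) ≈ y
  x+[y-x]≈y x y = ≈-trans (≈-sym (+-assoc x y (- x))) (xyx⁻¹≈y x y)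

  [x+y]-[y-z]≈x+z : ∀ x y z → (x + y) - (y - z) ≈ x + z
  [x+y]-[y-z]≈x+z x y z = begin
    (x + y) - (y - z)   ≈⟨ +-congˡ (⁻¹-anti-homo‿- y z) ⟩
    (x + y) + (z - y)   ≈⟨ interchange x y z (- y) ⟩
    (x + z) + (y - y)   ≈⟨ +-congˡ (-‿inverseʳ y) ⟩
    (x + z) + 0#        ≈⟨ +-identityʳ (x + z) ⟩
    x + z               ∎
    where open ≈-Reasoning

  x+z≈y+w⇒x-z≈[y-z]+[w-z] : ∀ {x y z w} → x + z ≈ y + w → x - z ≈ (y - z) + (w - z)
  x+z≈y+w⇒x-z≈[y-z]+[w-z] {x} {y} {z} {w} x+z≈y+w = begin
    x - z                 ≈⟨ +-congʳ (x+y-y≈x x z) ⟨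
    ((x + z) - z) - z     ≈⟨ +-congʳ (+-congʳ x+z≈y+w) ⟩
    ((y + w) - z) - z     ≈⟨ +-assoc (y + w) (- z) (- z) ⟩
    (y + w) + (- z - z)   ≈⟨ interchange y w (- z) (- z) ⟩
    (y - z) + (w - z)     ∎
    where
    open ≈-Reasoning
    x+y-y≈x : ∀ x y → (x + y) - y ≈ x
    x+y-y≈x x y = ≈-trans (+-assoc x y (- y)) (≈-trans (+-congˡ (-‿inverseʳ y)) (+-identityʳ x))

  +-mono-≤₂ : ∀ {a b c d} → a ≤ b → c ≤ d → a + c ≤ b + d
  +-mono-≤₂ {a} {b} {c} {d} a≤b c≤d = begin
    a + c  ≤⟨ +-mono-≤ c a≤b ⟩
    b + c  ≈⟨ +-comm b c ⟩
    c + b  ≤⟨ +-mono-≤ b c≤d ⟩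
    d + b  ≈⟨ +-comm d b ⟩
    b + d  ∎
    where open ≤-Reasoning

  x≤y⇒0≤y-x : ∀ {x y} → x ≤ y → 0# ≤ y - x
  x≤y⇒0≤y-x {x} {y} x≤y = begin
    0#      ≈⟨ -‿inverseʳ x ⟨
    x - x   ≤⟨ +-mono-≤ (- x) x≤y ⟩
    y - x   ∎
    where open ≤-Reasoning

  0≤y-x⇒x≤y : ∀ {x y} → 0# ≤ y - x → x ≤ y
  0≤y-x⇒x≤y {x} {y} 0≤y-x = begin
    x              ≈⟨ +-identityˡ x ⟨
    0# + x         ≤⟨ +-mono-≤ x 0≤y-x ⟩
    (y - x) + x    ≈⟨ +-assoc y (- x) x ⟩
    y + (- x + x)  ≈⟨ +-congˡ (-‿inverseˡ x) ⟩
    y + 0#         ≈⟨ +-identityʳ y ⟩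
    y              ∎
    where open ≤-Reasoning

  0≤x⇒-x≤0 : ∀ {x} → 0# ≤ x → - x ≤ 0#
  0≤x⇒-x≤0 {x} 0≤x = begin
    - x      ≈⟨ +-identityˡ (- x) ⟨
    0# - x   ≤⟨ +-mono-≤ (- x) 0≤x ⟩
    x - x    ≈⟨ -‿inverseʳ x ⟩
    0#       ∎
    where open ≤-Reasoning

  *-monoˡ-≤-nonneg : ∀ {c a b} → 0# ≤ c → a ≤ b → c * a ≤ c * b
  *-monoˡ-≤-nonneg {c} {a} {b} 0≤c a≤b = 0≤y-x⇒x≤y (begin
    0#                ≤⟨ *-nonneg 0≤c (x≤y⇒0≤y-x a≤b) ⟩
    c * (b - a)       ≈⟨ x[y-z]≈xy-xz c b a ⟩
    c * b - c * a     ∎)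
    where open ≤-Reasoning

  -- In an ordered ring, 1 ≤ 0 would make 1 = (−1)(−1) nonnegative as well.
  0≤1 : 0# ≤ 1#
  0≤1 with total 0# 1#
  ... | inj₁ 0≤1 = 0≤1
  ... | inj₂ 1≤0 = ⊥-elim (0≉1 (antisym 0≤1′ 1≤0))
    where
    open ≤-Reasoning
    0≤-1 : 0# ≤ - 1#
    0≤-1 = begin
      0#          ≈⟨ -‿inverseʳ 1# ⟨
      1# - 1#     ≤⟨ +-mono-≤ (- 1#) 1≤0 ⟩
      0# - 1#     ≈⟨ +-identityˡ (- 1#) ⟩
      - 1#        ∎
    0≤1′ : 0# ≤ 1#
    0≤1′ = begin
      0#              ≤⟨ *-nonneg 0≤-1 0≤-1 ⟩
      - 1# * - 1#     ≈⟨ -‿distribʳ-* (- 1#) 1# ⟨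
      - (- 1# * 1#)   ≈⟨ -‿cong (*-identityʳ (- 1#)) ⟩
      - (- 1#)        ≈⟨ ⁻¹-involutive 1# ⟩
      1#              ∎

  sumFin≡sum : ∀ {n} (f : Vector Carrier n) → sumFin F f ≡ sum f
  sumFin≡sum {zero} f = refl
  sumFin≡sum {suc n} f = cong (f zero +_) (sumFin≡sum (λ i → f (suc i)))

  sum-zero : ∀ {n} {f : Vector Carrier n} → (∀ i → f i ≈ 0#) → sum f ≈ 0#
  sum-zero {n} f≈0 = ≈-trans (sum-cong-≋ f≈0) (sum-replicate-zero n)

  sum-mono-≤ : ∀ {n} {f g : Vector Carrier n} → (∀ i → f i ≤ g i) → sum f ≤ sum g
  sum-mono-≤ {zero} f≤g = ≤-refl
  sum-mono-≤ {suc n} f≤g = +-mono-≤₂ (f≤g zero) (sum-mono-≤ (λ i → f≤g (suc i)))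

  sum-neg : ∀ {n} (f : Vector Carrier n) → sum (λ i → - f i) ≈ - sum f
  sum-neg {zero} f = ≈-sym ε⁻¹≈ε
  sum-neg {suc n} f = ≈-trans (+-congˡ (sum-neg (λ i → f (suc i)))) (⁻¹-∙-comm (f zero) _)

  sum-↑ : ∀ m {n} (f : Vector Carrier (m ℕ.+ n)) →
    sum f ≈ sum (λ i → f (i ↑ˡ n)) + sum (λ i → f (m ↑ʳ i))
  sum-↑ zero f = ≈-sym (+-identityˡ (sum f))
  sum-↑ (suc m) f = ≈-trans (+-congˡ (sum-↑ m (λ i → f (suc i)))) (≈-sym (+-assoc (f zero) _ _))

  mask : ∀ {n} → Subset n → Vector Carrier n → Vector Carrier n
  mask S x i = if lookup S i then x i else 0#

  sumOver≡sum-mask : ∀ {n} (S : Subset n) x → sumOver F S x ≡ sum (mask S x)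
  sumOver≡sum-mask S x = sumFin≡sum (mask S x)

  sumOver-⊥ : ∀ {n} (x : Vector Carrier n) → sumOver F ⊥ x ≈ 0#
  sumOver-⊥ {zero} x = ≈-refl
  sumOver-⊥ {suc n} x = ≈-trans (+-congˡ (sumOver-⊥ (λ i → x (suc i)))) (+-identityˡ 0#)

  sumOver-0 : ∀ {n} (S : Subset n) → sumOver F S (λ _ → 0#) ≈ 0#
  sumOver-0 S = ≈-trans (≈-reflexive (sumOver≡sum-mask S (λ _ → 0#))) (sum-zero (λ i → if-0 (lookup S i)))
    where
    if-0 : ∀ b → (if b then 0# else 0#) ≈ 0#
    if-0 true  = ≈-refl
    if-0 false = ≈-refl

  sumOver-modular : ∀ {n} (x : Vector Carrier n) → Modular F (λ S → sumOver F S x)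
  sumOver-modular x C D
    rewrite sumOver≡sum-mask (C ∪ D) x | sumOver≡sum-mask (C ∩ D) x
          | sumOver≡sum-mask C x | sumOver≡sum-mask D x = begin
    sum (mask (C ∪ D) x) + sum (mask (C ∩ D) x)          ≈⟨ ∑-distrib-+ (mask (C ∪ D) x) _ ⟨
    sum (λ i → mask (C ∪ D) x i + mask (C ∩ D) x i)     ≈⟨ sum-cong-≋ pointwise ⟩
    sum (λ i → mask C x i + mask D x i)                 ≈⟨ ∑-distrib-+ (mask C x) _ ⟩
    sum (mask C x) + sum (mask D x)                     ∎
    where
    open ≈-Reasoning
    bits : ∀ b b′ y → (if b ∨ b′ then y else 0#) + (if b ∧ b′ then y else 0#)
                      ≈ (if b then y else 0#) + (if b′ then y else 0#)
    bits true  true  y = ≈-refl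
    bits true  false y = ≈-refl
    bits false true  y = +-comm y 0#
    bits false false y = ≈-refl
    pointwise : ∀ i → mask (C ∪ D) x i + mask (C ∩ D) x i ≈ mask C x i + mask D x i
    pointwise i rewrite lookup-zipWith _∨_ i C D | lookup-zipWith _∧_ i C D =
      bits (lookup C i) (lookup D i) (x i)

  sumOver-linear : ∀ {n k} (S : Subset n) (c : Vector Carrier k) (x : Fin k → Vector Carrier n) →
    sumOver F S (λ i → sum (λ j → c j * x j i)) ≈ sum (λ j → c j * sumOver F S (x j))
  sumOver-linear S c x rewrite sumOver≡sum-mask S (λ i → sum (λ j → c j * x j i)) = begin
    sum (mask S (λ i → sum (λ j → c j * x j i)))
      ≈⟨ sum-cong-≋ (λ i → mask-linear (lookup S i) i) ⟩
    sum (λ i → sum (λ j → c j * mask S (x j) i))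
      ≈⟨ ∑-comm (λ i j → c j * mask S (x j) i) ⟩
    sum (λ j → sum (λ i → c j * mask S (x j) i))
      ≈⟨ sum-cong-≋ (λ j → *-distribˡ-sum (c j) (mask S (x j))) ⟨
    sum (λ j → c j * sum (mask S (x j)))
      ≈⟨ sum-cong-≋ (λ j → *-congˡ (≈-reflexive (sumOver≡sum-mask S (x j)))) ⟨
    sum (λ j → c j * sumOver F S (x j))
      ∎
    where
    open ≈-Reasoning
    mask-linear : ∀ b i → (if b then sum (λ j → c j * x j i) else 0#)
                          ≈ sum (λ j → c j * (if b then x j i else 0#))
    mask-linear true  i = ≈-refl
    mask-linear false i = ≈-sym (sum-zero (λ j → zeroʳ (c j)))

  tilde-cong : ∀ {n} {v w : SetFn F n} → (∀ S → v S ≈ w S) → ∀ S → tilde F v S ≈ tilde F w S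
  tilde-cong v≈w S = +-cong (v≈w S) (-‿cong (v≈w ⊥))

  tilde-sumFinFn : ∀ {n k} (c : Vector Carrier k) (v : Fin k → SetFn F n) S →
    tilde F (sumFinFn F c v) S ≈ sum (λ j → c j * tilde F (v j) S)
  tilde-sumFinFn c v S
    rewrite sumFin≡sum (λ j → c j * v j S) | sumFin≡sum (λ j → c j * v j ⊥) = begin
    sum (λ j → c j * v j S) - sum (λ j → c j * v j ⊥)        ≈⟨ +-congˡ (sum-neg (λ j → c j * v j ⊥)) ⟨
    sum (λ j → c j * v j S) + sum (λ j → - (c j * v j ⊥))    ≈⟨ ∑-distrib-+ (λ j → c j * v j S) _ ⟨
    sum (λ j → c j * v j S - c j * v j ⊥)                    ≈⟨ sum-cong-≋ (λ j → x[y-z]≈xy-xz (c j) (v j S) (v j ⊥)) ⟨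
    sum (λ j → c j * tilde F (v j) S)                        ∎
    where open ≈-Reasoning

  Modular-false∷ : ∀ {n} {v : SetFn F (suc n)} → Modular F v → Modular F (λ T → v (false ∷ T))
  Modular-false∷ v-mod C D = v-mod (false ∷ C) (false ∷ D)

  -- Split off the first point: modularity at C = {0}, D = S ∖ {0} gives
  -- m̃(S) = m̃({0}) + m̃(S ∖ {0}) whenever 0 ∈ S.
  Modular⇒tilde-additive : ∀ {n} (v : SetFn F n) → Modular F v →
    ∀ S → tilde F v S ≈ sumOver F S (λ i → tilde F v ⁅ i ⁆)
  Modular⇒tilde-additive {zero} v v-mod [] = -‿inverseʳ (v [])
  Modular⇒tilde-additive {suc n} v v-mod (false ∷ S) =
    ≈-trans (Modular⇒tilde-additive (λ T → v (false ∷ T)) (Modular-false∷ v-mod) S)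
            (≈-sym (+-identityˡ _))
  Modular⇒tilde-additive {suc n} v v-mod (true ∷ S) =
    ≈-trans (x+z≈y+w⇒x-z≈[y-z]+[w-z] split)
            (+-congˡ (Modular⇒tilde-additive (λ T → v (false ∷ T)) (Modular-false∷ v-mod) S))
    where
    split : v (true ∷ S) + v ⊥ ≈ v ⁅ zero ⁆ + v (false ∷ S)
    split = subst₂ (λ A B → v (true ∷ A) + v (false ∷ B) ≈ v ⁅ zero ⁆ + v (false ∷ S))
                   (∪-identityˡ S) (∩-zeroˡ S) (v-mod ⁅ zero ⁆ (false ∷ S))

  δ-≢ : ∀ {n} {S T : Subset n} → ¬ S ≡ T → δ F S T ≡ 0#
  δ-≢ {S = S} {T} S≢T with ≡-dec _≟ᵇ_ S T
  ... | yes S≡T = ⊥-elim (S≢T S≡T)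
  ... | no _    = refl

  δ-nonneg : ∀ {n} (S T : Subset n) → 0# ≤ δ F S T
  δ-nonneg S T with ≡-dec _≟ᵇ_ S T
  ... | yes _ = 0≤1
  ... | no _  = ≤-refl

  tilde-negδ : ∀ {n} {S : Subset n} → ¬ S ≡ ⊥ → ∀ T → tilde F (λ U → - δ F S U) T ≈ - δ F S T
  tilde-negδ {S = S} S≢⊥ T rewrite δ-≢ S≢⊥ =
    ≈-trans (+-congˡ (⁻¹-involutive 0#)) (+-identityʳ (- δ F S T))

  InB-resp : ∀ {n} {v w : SetFn F n} → (∀ S → v S ≈ w S) → InB F w → InB F v
  InB-resp v≈w (x , x-total , x-core) =
    x , ≈-trans x-total (≈-sym (tilde-cong v≈w ⊤)) ,
    λ S → ≤-trans (≤-reflexive (tilde-cong v≈w S)) (x-core S)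

  Modular⇒InB : ∀ {n} {v : SetFn F n} → Modular F v → InB F v
  Modular⇒InB {v = v} v-mod =
    (λ i → tilde F v ⁅ i ⁆) ,
    ≈-sym (Modular⇒tilde-additive v v-mod ⊤) ,
    λ S → ≤-reflexive (Modular⇒tilde-additive v v-mod S)

  InB-negδ : ∀ {n} {S : Subset n} → ¬ S ≡ ⊥ → ¬ S ≡ ⊤ → InB F (λ T → - δ F S T)
  InB-negδ {n} {S} S≢⊥ S≢⊤ = (λ _ → 0#) , total-eq , core
    where
    open ≤-Reasoning
    total-eq : sumOver F (⊤ {n}) (λ _ → 0#) ≈ tilde F (λ T → - δ F S T) ⊤
    total-eq = begin-equality
      sumOver F (⊤ {n}) (λ _ → 0#)   ≈⟨ sumOver-0 (⊤ {n}) ⟩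
      0#                             ≈⟨ ε⁻¹≈ε ⟨
      - 0#                           ≡⟨ cong -_ (δ-≢ S≢⊤) ⟨
      - δ F S ⊤                      ≈⟨ tilde-negδ S≢⊥ ⊤ ⟨
      tilde F (λ T → - δ F S T) ⊤    ∎
    core : ∀ T → tilde F (λ U → - δ F S U) T ≤ sumOver F T (λ _ → 0#)
    core T = begin
      tilde F (λ U → - δ F S U) T    ≈⟨ tilde-negδ S≢⊥ T ⟩
      - δ F S T                      ≤⟨ 0≤x⇒-x≤0 (δ-nonneg S T) ⟩
      0#                             ≈⟨ sumOver-0 T ⟨
      sumOver F T (λ _ → 0#)         ∎

  Generators⇒InB : ∀ {n} {v : SetFn F n} → Generators F v → InB F v
  Generators⇒InB (inj₁ v-mod)                    = Modular⇒InB v-mod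
  Generators⇒InB (inj₂ (S , S≢⊥ , S≢⊤ , v≈-δ)) = InB-resp v≈-δ (InB-negδ S≢⊥ S≢⊤)

  InB-sumFinFn : ∀ {n k} (c : Vector Carrier k) (v : Fin k → SetFn F n) →
    (∀ j → 0# ≤ c j) → (∀ j → InB F (v j)) → InB F (sumFinFn F c v)
  InB-sumFinFn {n} c v c≥0 v∈B = x , total-eq , core
    where
    y : Fin _ → Vector Carrier n
    y j = proj₁ (v∈B j)
    x : Vector Carrier n
    x i = sum (λ j → c j * y j i)
    open ≤-Reasoning
    total-eq : sumOver F ⊤ x ≈ tilde F (sumFinFn F c v) ⊤
    total-eq = begin-equality
      sumOver F ⊤ x                         ≈⟨ sumOver-linear ⊤ c y ⟩
      sum (λ j → c j * sumOver F ⊤ (y j))   ≈⟨ sum-cong-≋ (λ j → *-congˡ (proj₁ (proj₂ (v∈B j)))) ⟩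
      sum (λ j → c j * tilde F (v j) ⊤)     ≈⟨ tilde-sumFinFn c v ⊤ ⟨
      tilde F (sumFinFn F c v) ⊤            ∎
    core : ∀ S → tilde F (sumFinFn F c v) S ≤ sumOver F S x
    core S = begin
      tilde F (sumFinFn F c v) S            ≈⟨ tilde-sumFinFn c v S ⟩
      sum (λ j → c j * tilde F (v j) S)     ≤⟨ sum-mono-≤ (λ j → *-monoˡ-≤-nonneg (c≥0 j) (proj₂ (proj₂ (v∈B j)) S)) ⟩
      sum (λ j → c j * sumOver F S (y j))   ≈⟨ sumOver-linear S c y ⟨
      sumOver F S x                         ∎

  ConicHull⇒InB : ∀ {n} (m : SetFn F n) → ConicHull F (Generators F) m → InB F m
  ConicHull⇒InB m (k , c , v , c≥0 , v∈G , m≈) =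
    InB-resp m≈ (InB-sumFinFn c v c≥0 (λ j → Generators⇒InB (v∈G j)))

  #subsets : ℕ → ℕ
  #subsets zero    = 1
  #subsets (suc n) = #subsets n ℕ.+ #subsets n

  subsets : ∀ n → Vector (Subset n) (#subsets n)
  subsets zero    = λ _ → []
  subsets (suc n) = map (false ∷_) (subsets n) ++ map (true ∷_) (subsets n)

  sum-subsets-suc : ∀ {n} (h : Subset (suc n) → Carrier) →
    sum (λ j → h (subsets (suc n) j))
      ≈ sum (λ j → h (false ∷ subsets n j)) + sum (λ j → h (true ∷ subsets n j))
  sum-subsets-suc {n} h = ≈-trans (sum-↑ (#subsets n) (λ j → h (subsets (suc n) j)))
    (+-cong (sum-cong-≋ (λ j → ≈-reflexive (cong h (lookup-++ˡ without₀ with₀ j))))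
            (sum-cong-≋ (λ j → ≈-reflexive (cong h (lookup-++ʳ without₀ with₀ j)))))
    where
    without₀ with₀ : Vector (Subset (suc n)) (#subsets n)
    without₀ = map (false ∷_) (subsets n)
    with₀    = map (true ∷_) (subsets n)

  sum-subsets-δ : ∀ {n} (f : Subset n → Carrier) T →
    sum (λ j → f (subsets n j) * δ F (subsets n j) T) ≈ f T
  sum-subsets-δ {zero} f [] = ≈-trans (+-identityʳ (f [] * 1#)) (*-identityʳ (f []))
  sum-subsets-δ {suc n} f (false ∷ T) = begin
    sum (λ j → f (subsets (suc n) j) * δ F (subsets (suc n) j) (false ∷ T))
      ≈⟨ sum-subsets-suc (λ S → f S * δ F S (false ∷ T)) ⟩
    sum (λ j → f (false ∷ subsets n j) * δ F (subsets n j) T) + sum (λ j → f (true ∷ subsets n j) * 0#)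
      ≈⟨ +-cong (sum-subsets-δ (λ S → f (false ∷ S)) T) (sum-zero (λ j → zeroʳ (f (true ∷ subsets n j)))) ⟩
    f (false ∷ T) + 0#
      ≈⟨ +-identityʳ _ ⟩
    f (false ∷ T) ∎
    where open ≈-Reasoning
  sum-subsets-δ {suc n} f (true ∷ T) = begin
    sum (λ j → f (subsets (suc n) j) * δ F (subsets (suc n) j) (true ∷ T))
      ≈⟨ sum-subsets-suc (λ S → f S * δ F S (true ∷ T)) ⟩
    sum (λ j → f (false ∷ subsets n j) * 0#) + sum (λ j → f (true ∷ subsets n j) * δ F (subsets n j) T)
      ≈⟨ +-cong (sum-zero (λ j → zeroʳ (f (false ∷ subsets n j)))) (sum-subsets-δ (λ S → f (true ∷ S)) T) ⟩
    0# + f (true ∷ T)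
      ≈⟨ +-identityˡ _ ⟩
    f (true ∷ T) ∎
    where open ≈-Reasoning

  x≈0⇒x*y≈-[x*z] : ∀ {x} → x ≈ 0# → ∀ {y z} → x * y ≈ - (x * z)
  x≈0⇒x*y≈-[x*z] {x} x≈0 {y} {z} = begin
    x * y        ≈⟨ *-cong x≈0 ≈-refl ⟩
    0# * y       ≈⟨ zeroˡ y ⟩
    0#           ≈⟨ ε⁻¹≈ε ⟨
    - 0#         ≈⟨ -‿cong (zeroˡ z) ⟨
    - (0# * z)   ≈⟨ -‿cong (*-cong x≈0 ≈-refl) ⟨
    - (x * z)    ∎
    where open ≈-Reasoning

  Modular-+const : ∀ {n} {v : SetFn F n} a → Modular F v → Modular F (λ T → a + v T)
  Modular-+const {v = v} a v-mod C D = begin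
    (a + v (C ∪ D)) + (a + v (C ∩ D))   ≈⟨ interchange a (v (C ∪ D)) a (v (C ∩ D)) ⟩
    (a + a) + (v (C ∪ D) + v (C ∩ D))   ≈⟨ +-congˡ (v-mod C D) ⟩
    (a + a) + (v C + v D)               ≈⟨ interchange a (v C) a (v D) ⟨
    (a + v C) + (a + v D)               ∎
    where open ≈-Reasoning

  -- At S = ∅ and S = N, where −δ_S is not a generator, the zero function serves instead.
  scaled-negδ-generated : ∀ {n} (a : Subset n → Carrier) → a ⊥ ≈ 0# → a ⊤ ≈ 0# → ∀ S →
    ∃ λ g → Generators F g × (∀ T → a S * g T ≈ - (a S * δ F S T))
  scaled-negδ-generated a a⊥≈0 a⊤≈0 S with ≡-dec _≟ᵇ_ S ⊥ | ≡-dec _≟ᵇ_ S ⊤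
  ... | yes refl | _        = (λ _ → 0#) , inj₁ (λ _ _ → ≈-refl) , λ T → x≈0⇒x*y≈-[x*z] a⊥≈0
  ... | no _     | yes refl = (λ _ → 0#) , inj₁ (λ _ _ → ≈-refl) , λ T → x≈0⇒x*y≈-[x*z] a⊤≈0
  ... | no S≢⊥   | no S≢⊤   =
    (λ T → - δ F S T) , inj₂ (S , S≢⊥ , S≢⊤ , λ _ → ≈-refl) , λ T → ≈-sym (-‿distribʳ-* (a S) (δ F S T))

  excess : ∀ {n} → SetFn F n → Vector Carrier n → Subset n → Carrier
  excess m x T = sumOver F T x - tilde F m T

  excess-⊥ : ∀ {n} (m : SetFn F n) x → excess m x ⊥ ≈ 0#
  excess-⊥ m x = x≈y⇒x∙y⁻¹≈ε (≈-trans (sumOver-⊥ x) (≈-sym (-‿inverseʳ (m ⊥))))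

  excess-decomposition : ∀ {n} (m : SetFn F n) x T → m T ≈ (m ⊥ + sumOver F T x) - excess m x T
  excess-decomposition m x T = begin
    m T                                        ≈⟨ x+[y-x]≈y (m ⊥) (m T) ⟨
    m ⊥ + tilde F m T                          ≈⟨ [x+y]-[y-z]≈x+z (m ⊥) (sumOver F T x) (tilde F m T) ⟨
    (m ⊥ + sumOver F T x) - excess m x T       ∎
    where open ≈-Reasoning

  InB⇒ConicHull : ∀ {n} (m : SetFn F n) → InB F m → ConicHull F (Generators F) m
  InB⇒ConicHull {n} m (x , x-total , x-core) = suc (#subsets n) , coeff , gen , coeff≥0 , gen∈G , m≈
    where
    M : SetFn F n
    M T = m ⊥ + sumOver F T x

    d : Subset n → Carrier
    d = excess m x

    negδ-part : ∀ S → ∃ λ g → Generators F g × (∀ T → d S * g T ≈ - (d S * δ F S T))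
    negδ-part = scaled-negδ-generated d (excess-⊥ m x) (x≈y⇒x∙y⁻¹≈ε x-total)

    coeff : Vector Carrier (suc (#subsets n))
    coeff zero    = 1#
    coeff (suc j) = d (subsets n j)

    gen : Fin (suc (#subsets n)) → SetFn F n
    gen zero    = M
    gen (suc j) = proj₁ (negδ-part (subsets n j))

    coeff≥0 : ∀ j → 0# ≤ coeff j
    coeff≥0 zero    = 0≤1
    coeff≥0 (suc j) = x≤y⇒0≤y-x (x-core (subsets n j))

    gen∈G : ∀ j → Generators F (gen j)
    gen∈G zero    = inj₁ (Modular-+const (m ⊥) (sumOver-modular x))
    gen∈G (suc j) = proj₁ (proj₂ (negδ-part (subsets n j)))

    m≈ : ∀ T → m T ≈ sumFinFn F coeff gen T
    m≈ T rewrite sumFin≡sum (λ j → coeff j * gen j T) = begin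
      m T
        ≈⟨ excess-decomposition m x T ⟩
      M T - d T
        ≈⟨ +-congˡ (-‿cong (sum-subsets-δ d T)) ⟨
      M T - sum (λ j → d (subsets n j) * δ F (subsets n j) T)
        ≈⟨ +-congˡ (sum-neg (λ j → d (subsets n j) * δ F (subsets n j) T)) ⟨
      M T + sum (λ j → - (d (subsets n j) * δ F (subsets n j) T))
        ≈⟨ +-cong (*-identityˡ (M T)) (sum-cong-≋ (λ j → proj₂ (proj₂ (negδ-part (subsets n j))) T)) ⟨
      1# * M T + sum (λ j → d (subsets n j) * gen (suc j) T)
        ∎
      where open ≈-Reasoning

corollary3 : (F : OrderedField) (n : ℕ) → n ≥ 2 → (m : SetFn F n) →
    (InB F m → ConicHull F (Generators F) m) × (ConicHull F (Generators F) m → InB F m)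
corollary3 F n _ m = InB⇒ConicHull F m , ConicHull⇒InB F m
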